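{- Let $\lambda\in\mathbb{C}$, let $r$ be a nonnegative integer, and let $S_\lambda$ be the complex unital associative algebra generated by $a$ and $a^\dagger$ subject to $aa^\dagger-a^\dagger a=\lambda a$ (with $r$ identified with $r\cdot 1$). Then for every integer $n\ge0$, \[ ((a^\dagger+r)a)^n=\sum_{k=0}^n {n+r \brack k+r}_{r,\lambda}(a^\dagger)^k a^n . \]
   Context: For $\lambda\in\mathbb{C}$, the $\lambda$-rising factorial is $\langle x\rangle_{0,\lambda}=1$, $\langle x\rangle_{n,\lambda}=x(x+\lambda)\cdots(x+(n-1)\lambda)$ for $n\ge1$. For a nonnegative integer $r$, the $\lambda$-$r$-Stirling numbers of the first kind ${n+r \brack k+r}_{r,\lambda}$ ($0\le k\le n$) are defined by $\langle x+r\rangle_{n,\lambda}=\sum_{k=0}^n {n+r \brack k+r}_{r,\lambda} x^k$. -}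

module Defs where

open import Level using (Level)
open import Data.Nat using (ℕ; zero; suc)
open import Algebra.Bundles using (Ring; Semiring)
import Algebra.Definitions.RawSemiring as RS

module Ops {c ℓ : Level} (R : Ring c ℓ) =
  RS (Semiring.rawSemiring (Ring.semiring R))

module _ {c ℓ : Level} (R : Ring c ℓ) where
  open Ring R using (Carrier; _+_; _*_; 0#; 1#)
  open Ops R using (_×_; _^_)

  -- A polynomial in one variable x over R, as its coefficient sequence
  -- (coefficient of x^k at index k).
  Poly : Set c
  Poly = ℕ → Carrier

  mulLin : Poly → Carrier → Poly
  mulLin p e zero    = p zero * e
  mulLin p e (suc k) = p k + p (suc k) * e

  -- the lambda-rising factorial <x + r>_{n,λ} = (x+r)(x+r+λ)...(x+r+(n-1)λ),
  -- as a polynomial in x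
  risingShift : (λ′ : Carrier) (r n : ℕ) → Poly
  risingShift λ′ r zero    zero    = 1#
  risingShift λ′ r zero    (suc k) = 0#
  risingShift λ′ r (suc n)         =
    mulLin (risingShift λ′ r n) ((r × 1#) + (n × λ′))

  -- λ-r-Stirling number of the first kind [n+r, k+r]_{r,λ}:
  -- the coefficient of x^k in <x + r>_{n,λ}.
  stirling1 : (λ′ : Carrier) (r n k : ℕ) → Carrier
  stirling1 λ′ r n k = risingShift λ′ r n k

{-# OPTIONS --safe #-}

-- Ordering a word in a and y = a† + r so that every a stands on the right
-- only needs the relation a·y = (y + λ)·a, hence a^n·y = (y + nλ)·a^n. So if
-- (y a)^n = Q_n(a†)·a^n, then (y a)^(n+1) = Q_n(a†)·(a† + r + nλ)·a^(n+1):
-- the polynomials Q_n obey the recursion defining ⟨x + r⟩_{n,λ}, whose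
-- coefficients are the λ-r-Stirling numbers.
module Submission where

open import Defs
open import Level using (Level; _⊔_)
open import Data.Nat using (ℕ; zero; suc; _<_; s<s)
open import Data.Nat.Properties using (m<n⇒m<1+n; n<1+n)
open import Data.Fin using (toℕ)
open import Data.Fin.Properties using (toℕ-inject₁; toℕ-fromℕ)
open import Algebra.Bundles using (Ring)
import Algebra.Properties.CommutativeSemigroup as CommutativeSemigroupProperties
import Algebra.Properties.Group as GroupProperties
import Algebra.Properties.Semiring.Mult as MultProperties
import Algebra.Properties.Semiring.Sum as SumProperties
open import Relation.Binary.PropositionalEquality using (cong; cong₂)
import Relation.Binary.Reasoning.Setoid as SetoidReasoning

module NormalOrdering {c ℓ : Level} (R : Ring c ℓ) where
  open Ring R
  open Ops R
  open SetoidReasoning setoid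
  open CommutativeSemigroupProperties +-commutativeSemigroup using (xy∙z≈x∙zy; xy∙z≈xz∙y)
  open GroupProperties +-group using (//-rightDividesˡ)
  open MultProperties semiring using (×-congʳ; ×-assoc-*; ×-comm-*)
  open SumProperties semiring using (sum-init-last; sum-cong-≗; sum-cong-≋; *-distribʳ-sum)

  Central : Carrier → Set (c ⊔ ℓ)
  Central z = ∀ y → z * y ≈ y * z

  central-1# : Central 1#
  central-1# y = trans (*-identityˡ y) (sym (*-identityʳ y))

  central-+ : ∀ {u v} → Central u → Central v → Central (u + v)
  central-+ {u} {v} u-central v-central y = begin
    (u + v) * y     ≈⟨ distribʳ y u v ⟩
    u * y + v * y   ≈⟨ +-cong (u-central y) (v-central y) ⟩
    y * u + y * v   ≈⟨ distribˡ y u v ⟨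
    y * (u + v)     ∎

  central-× : ∀ n {z} → Central z → Central (n × z)
  central-× n {z} z-central y = begin
    (n × z) * y   ≈⟨ ×-assoc-* n z y ⟩
    n × (z * y)   ≈⟨ ×-congʳ n (z-central y) ⟩
    n × (y * z)   ≈⟨ ×-comm-* n y z ⟨
    y * (n × z)   ∎

  ^-suc-snoc : ∀ x n → x ^ suc n ≈ x ^ n * x
  ^-suc-snoc x zero    = trans (*-identityʳ x) (sym (*-identityˡ x))
  ^-suc-snoc x (suc n) = begin
    x * x ^ suc n     ≈⟨ *-congˡ (^-suc-snoc x n) ⟩
    x * (x ^ n * x)   ≈⟨ *-assoc x (x ^ n) x ⟨
    x * x ^ n * x     ∎

  sum-toℕ-init-last : ∀ m (f : ℕ → Carrier) →
    sum {suc m} (λ k → f (toℕ k)) ≈ sum {m} (λ k → f (toℕ k)) + f m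
  sum-toℕ-init-last m f = trans (sum-init-last (λ k → f (toℕ k))) (reflexive
    (cong₂ _+_ (sum-cong-≗ {m} (λ k → cong f (toℕ-inject₁ k))) (cong f (toℕ-fromℕ m))))

  -- Coefficients stand on the left of the powers of x: R need not be commutative.
  eval : ℕ → Poly R → Carrier → Carrier
  eval m p x = sum {m} (λ k → p (toℕ k) * x ^ toℕ k)

  eval-suc : ∀ m p x → eval (suc m) p x ≈ eval m p x + p m * x ^ m
  eval-suc m p x = sum-toℕ-init-last m (λ k → p k * x ^ k)

  eval-*ʳ : ∀ m p x z → eval m p x * z ≈ sum {m} (λ k → p (toℕ k) * (x ^ toℕ k * z))
  eval-*ʳ m p x z = trans (*-distribʳ-sum {m} z (λ k → p (toℕ k) * x ^ toℕ k))
                          (sum-cong-≋ {m} (λ k → *-assoc (p (toℕ k)) (x ^ toℕ k) z))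

  monomial-*-linear : ∀ {e} → Central e → ∀ q x m →
    q * x ^ m * (x + e) ≈ q * x ^ suc m + q * e * x ^ m
  monomial-*-linear {e} e-central q x m = begin
    q * x ^ m * (x + e)                ≈⟨ distribˡ (q * x ^ m) x e ⟩
    q * x ^ m * x + q * x ^ m * e      ≈⟨ +-cong (*-assoc q (x ^ m) x) (*-assoc q (x ^ m) e) ⟩
    q * (x ^ m * x) + q * (x ^ m * e)  ≈⟨ +-cong (*-congˡ (^-suc-snoc x m)) (*-congˡ (e-central (x ^ m))) ⟨
    q * x ^ suc m + q * (e * x ^ m)    ≈⟨ +-congˡ (*-assoc q e (x ^ m)) ⟨
    q * x ^ suc m + q * e * x ^ m      ∎

  eval-mulLin : ∀ {e} → Central e → ∀ m p x →
    eval (suc m) (mulLin R p e) x ≈ eval m p x * (x + e) + p m * e * x ^ m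
  eval-mulLin {e} e-central zero p x = begin
    p 0 * e * 1# + 0#            ≈⟨ +-comm _ 0# ⟩
    0# + p 0 * e * 1#            ≈⟨ +-congʳ (zeroˡ (x + e)) ⟨
    0# * (x + e) + p 0 * e * 1#  ∎
  eval-mulLin {e} e-central (suc m) p x = begin
    eval (suc (suc m)) (mulLin R p e) x
      ≈⟨ eval-suc (suc m) (mulLin R p e) x ⟩
    eval (suc m) (mulLin R p e) x + (p m + p (suc m) * e) * x ^ suc m
      ≈⟨ +-cong (eval-mulLin e-central m p x) (distribʳ (x ^ suc m) (p m) (p (suc m) * e)) ⟩
    (E * (x + e) + p m * e * x ^ m) + (p m * x ^ suc m + p (suc m) * e * x ^ suc m)
      ≈⟨ +-assoc _ _ _ ⟨
    ((E * (x + e) + p m * e * x ^ m) + p m * x ^ suc m) + p (suc m) * e * x ^ suc m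
      ≈⟨ +-congʳ (xy∙z≈x∙zy _ _ _) ⟩
    (E * (x + e) + (p m * x ^ suc m + p m * e * x ^ m)) + p (suc m) * e * x ^ suc m
      ≈⟨ +-congʳ (+-congˡ (monomial-*-linear e-central (p m) x m)) ⟨
    (E * (x + e) + p m * x ^ m * (x + e)) + p (suc m) * e * x ^ suc m
      ≈⟨ +-congʳ (distribʳ (x + e) E (p m * x ^ m)) ⟨
    (E + p m * x ^ m) * (x + e) + p (suc m) * e * x ^ suc m
      ≈⟨ +-congʳ (*-congʳ (eval-suc m p x)) ⟨
    eval (suc m) p x * (x + e) + p (suc m) * e * x ^ suc m
      ∎
    where
    E : Carrier
    E = eval m p x

  module _ (λ′ : Carrier) (r : ℕ) where
    P : ℕ → Poly R
    P = risingShift R λ′ r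

    shift : ℕ → Carrier
    shift n = (r × 1#) + (n × λ′)

    risingShift-vanishes : ∀ {n k} → n < k → P n k ≈ 0#
    risingShift-vanishes {zero}  {suc k} _         = refl
    risingShift-vanishes {suc n} {suc k} (s<s n<k) = begin
      P n k + P n (suc k) * shift n  ≈⟨ +-cong (risingShift-vanishes n<k)
                                          (*-congʳ (risingShift-vanishes (m<n⇒m<1+n n<k))) ⟩
      0# + 0# * shift n              ≈⟨ +-identityˡ _ ⟩
      0# * shift n                   ≈⟨ zeroˡ _ ⟩
      0#                             ∎

    eval-risingShift-suc : Central λ′ → ∀ n x →
      eval (suc (suc n)) (P (suc n)) x ≈ eval (suc n) (P n) x * (x + shift n)
    eval-risingShift-suc λ′-central n x = begin
      eval (suc (suc n)) (P (suc n)) x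
        ≈⟨ eval-mulLin shift-central (suc n) (P n) x ⟩
      eval (suc n) (P n) x * (x + shift n) + P n (suc n) * shift n * x ^ suc n
        ≈⟨ +-congˡ (*-congʳ (*-congʳ (risingShift-vanishes (n<1+n n)))) ⟩
      eval (suc n) (P n) x * (x + shift n) + 0# * shift n * x ^ suc n
        ≈⟨ +-congˡ (trans (*-congʳ (zeroˡ (shift n))) (zeroˡ (x ^ suc n))) ⟩
      eval (suc n) (P n) x * (x + shift n) + 0#
        ≈⟨ +-identityʳ _ ⟩
      eval (suc n) (P n) x * (x + shift n)
        ∎
      where
      shift-central : Central (shift n)
      shift-central = central-+ (central-× r central-1#) (central-× n λ′-central)

  module _ {a λ′ : Carrier} (λ′-central : Central λ′) where
    commutator⇒shift : ∀ {y} → a * y - y * a ≈ λ′ * a → a * y ≈ (y + λ′) * a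
    commutator⇒shift {y} [a,y]≈λa = begin
      a * y                  ≈⟨ //-rightDividesˡ (y * a) (a * y) ⟨
      a * y - y * a + y * a  ≈⟨ +-congʳ [a,y]≈λa ⟩
      λ′ * a + y * a         ≈⟨ +-comm _ _ ⟩
      y * a + λ′ * a         ≈⟨ distribʳ a y λ′ ⟨
      (y + λ′) * a           ∎

    shift-+-central : ∀ {y z} → Central z → a * y ≈ (y + λ′) * a → a * (y + z) ≈ (y + z + λ′) * a
    shift-+-central {y} {z} z-central ay≈[y+λ]a = begin
      a * (y + z)              ≈⟨ distribˡ a y z ⟩
      a * y + a * z            ≈⟨ +-cong ay≈[y+λ]a (sym (z-central a)) ⟩
      (y + λ′) * a + z * a     ≈⟨ distribʳ a (y + λ′) z ⟨
      (y + λ′ + z) * a         ≈⟨ *-congʳ (xy∙z≈xz∙y y λ′ z) ⟩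
      (y + z + λ′) * a         ∎

    pow-shift : ∀ {y} → a * y ≈ (y + λ′) * a → ∀ n → a ^ n * y ≈ (y + n × λ′) * a ^ n
    pow-shift {y} ay≈[y+λ]a zero = begin
      1# * y         ≈⟨ *-identityˡ y ⟩
      y              ≈⟨ +-identityʳ y ⟨
      y + 0#         ≈⟨ *-identityʳ (y + 0#) ⟨
      (y + 0#) * 1#  ∎
    pow-shift {y} ay≈[y+λ]a (suc n) = begin
      a * a ^ n * y                 ≈⟨ *-assoc a (a ^ n) y ⟩
      a * (a ^ n * y)               ≈⟨ *-congˡ (pow-shift ay≈[y+λ]a n) ⟩
      a * ((y + n × λ′) * a ^ n)    ≈⟨ *-assoc a _ (a ^ n) ⟨
      a * (y + n × λ′) * a ^ n      ≈⟨ *-congʳ (shift-+-central (central-× n λ′-central) ay≈[y+λ]a) ⟩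
      (y + n × λ′ + λ′) * a * a ^ n ≈⟨ *-assoc _ a (a ^ n) ⟩
      (y + n × λ′ + λ′) * a ^ suc n ≈⟨ *-congʳ (xy∙z≈x∙zy y (n × λ′) λ′) ⟩
      (y + suc n × λ′) * a ^ suc n  ∎

  power-normalOrdered : ∀ {λ′ a x} → Central λ′ → (r : ℕ) → a * x - x * a ≈ λ′ * a →
    ∀ n → ((x + r × 1#) * a) ^ n ≈ eval (suc n) (P λ′ r n) x * a ^ n
  power-normalOrdered λ′-central r [a,x]≈λa zero = begin
    1#                   ≈⟨ *-identityʳ 1# ⟨
    1# * 1#              ≈⟨ +-identityʳ (1# * 1#) ⟨
    1# * 1# + 0#         ≈⟨ *-identityʳ _ ⟨
    (1# * 1# + 0#) * 1#  ∎
  power-normalOrdered {λ′} {a} {x} λ′-central r [a,x]≈λa (suc n) = begin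
    (y * a) ^ suc n                          ≈⟨ ^-suc-snoc (y * a) n ⟩
    (y * a) ^ n * (y * a)                    ≈⟨ *-congʳ (power-normalOrdered λ′-central r [a,x]≈λa n) ⟩
    Q * a ^ n * (y * a)                      ≈⟨ *-assoc Q (a ^ n) (y * a) ⟩
    Q * (a ^ n * (y * a))                    ≈⟨ *-congˡ (*-assoc (a ^ n) y a) ⟨
    Q * (a ^ n * y * a)                      ≈⟨ *-congˡ (*-congʳ a^n*y) ⟩
    Q * ((x + shift λ′ r n) * a ^ n * a)     ≈⟨ *-congˡ (*-assoc _ (a ^ n) a) ⟩
    Q * ((x + shift λ′ r n) * (a ^ n * a))   ≈⟨ *-congˡ (*-congˡ (^-suc-snoc a n)) ⟨
    Q * ((x + shift λ′ r n) * a ^ suc n)     ≈⟨ *-assoc Q _ (a ^ suc n) ⟨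
    Q * (x + shift λ′ r n) * a ^ suc n       ≈⟨ *-congʳ (eval-risingShift-suc λ′ r λ′-central n x) ⟨
    eval (suc (suc n)) (P λ′ r (suc n)) x * a ^ suc n ∎
    where
    y : Carrier
    y = x + r × 1#

    Q : Carrier
    Q = eval (suc n) (P λ′ r n) x

    a^n*y : a ^ n * y ≈ (x + shift λ′ r n) * a ^ n
    a^n*y = trans
      (pow-shift λ′-central (shift-+-central λ′-central (central-× r central-1#)
                               (commutator⇒shift λ′-central [a,x]≈λa)) n)
      (*-congʳ (+-assoc x (r × 1#) (n × λ′)))

theorem2 : {c ℓ : Level} (R : Ring c ℓ) →
    let open Ring R
        open Ops R
    in (λ′ : Carrier) → (∀ x → λ′ * x ≈ x * λ′) →
       (r : ℕ) (a a† : Carrier) →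
       a * a† - a† * a ≈ λ′ * a →
       (n : ℕ) →
       (((a† + (r × 1#)) * a) ^ n)
         ≈ sum {suc n} (λ k → stirling1 R λ′ r n (toℕ k) * ((a† ^ toℕ k) * (a ^ n)))
theorem2 R λ′ λ′-central r a a† [a,a†]≈λa n = begin
  ((a† + r × 1#) * a) ^ n             ≈⟨ power-normalOrdered λ′-central r [a,a†]≈λa n ⟩
  eval (suc n) (P λ′ r n) a† * a ^ n  ≈⟨ eval-*ʳ (suc n) (P λ′ r n) a† (a ^ n) ⟩
  sum {suc n} (λ k → stirling1 R λ′ r n (toℕ k) * (a† ^ toℕ k * a ^ n)) ∎
  where
  open Ring R
  open Ops R
  open NormalOrdering R
  open SetoidReasoning setoid
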